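{- For every integer $n\ge1$, $$1\cdot\left(1+[2]_q\right)\left(1+[4]_q\right)\cdots\left(1+[2n-2]_q\right)=\sum_{\ell=1}^n s^A_{q^2}(n,\ell)\,(1+q)^{n-\ell}.$$
   Context: For $m\ge0$, $[m]_q=1+q+\cdots+q^{m-1}$. The polynomials $s^A_q(n,k)$ are defined by $s^A_q(0,k)=\delta_{0k}$, $s^A_q(n,k)=0$ for $k<0$, and $s^A_q(n,k)=s^A_q(n-1,k-1)+[n-1]_q s^A_q(n-1,k)$ for $n\ge1$; $s^A_{q^2}(n,\ell)$ denotes $s^A_q(n,\ell)$ with $q$ replaced by $q^2$. -}

module Defs where

open import Level using (Level)
open import Data.Nat using (ℕ; zero; suc; _∸_) renaming (_*_ to _ℕ*_)
open import Algebra.Bundles using (CommutativeRing)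

-- All definitions are generic in a commutative ring R and an element q of R.
-- (An identity holding for every q in every commutative ring is the same as
-- the polynomial identity in ℤ[q]: take R = ℤ[q] and q the indeterminate.)
module _ {c ℓ : Level} (R : CommutativeRing c ℓ) where
  open CommutativeRing R using (Carrier; _+_; _*_; 0#; 1#)

  pow : Carrier → ℕ → Carrier
  pow x zero    = 1#
  pow x (suc m) = x * pow x m

  qint : Carrier → ℕ → Carrier
  qint q zero    = 0#
  qint q (suc m) = qint q m + pow q m

  -- s^A_q(n,k), for k ≥ 0 (the value is 0 for k < 0, which is used in the k = 0 case):
  --   s(0,k) = δ_{0k},  s(n,k) = s(n-1,k-1) + [n-1]_q s(n-1,k)
  sA : Carrier → ℕ → ℕ → Carrier
  sA q zero    zero    = 1#
  sA q zero    (suc k) = 0#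
  sA q (suc n) zero    = qint q n * sA q n zero
  sA q (suc n) (suc k) = sA q n k + qint q n * sA q n (suc k)

  lhsProd : Carrier → ℕ → Carrier
  lhsProd q zero    = 1#
  lhsProd q (suc m) = lhsProd q m * (1# + qint q (2 ℕ* suc m))

  rhsSum : Carrier → ℕ → ℕ → Carrier
  rhsSum q n zero    = 0#
  rhsSum q n (suc m) = rhsSum q n m + sA (q * q) n (suc m) * pow (1# + q) (n ∸ suc m)

-- Writing p = q² and x = 1 + q, the triangular recurrence of s^A_p says that the
-- Horner-type partial sums  H(n, m) = Σ_{k ≤ m} s^A_p(n,k) x^(m-k)  satisfy
-- H(n+1, m+1) = H(n, m) + [n]_p H(n, m+1). Since s^A_p(n,k) = 0 for k > n, the
-- sums stabilise once m ≥ n, and by induction H(n, n) = ∏_{i<n} (1 + [i]_p x).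
-- Finally [i]_{q²} (1 + q) = [2i]_q, and s^A_p(n,0) = 0 for n ≥ 1 turns
-- H(n, n) into the right-hand side.
module Submission where

open import Defs
open import Level using (Level)
open import Data.Nat using (ℕ; zero; suc; _≥_; _≤_; _∸_) renaming (_+_ to _ℕ+_; _*_ to _ℕ*_)
import Data.Nat.Properties as ℕ
open import Algebra.Bundles using (CommutativeRing)
open import Relation.Binary.PropositionalEquality using (_≡_; cong)
import Algebra.Solver.Ring.NaturalCoefficients.Default as NaturalCoefficients
import Relation.Binary.Reasoning.Setoid as SetoidReasoning

module _ {c ℓ : Level} (R : CommutativeRing c ℓ) where
  open CommutativeRing R hiding (zero)
  open NaturalCoefficients commutativeSemiring using (solve; con; _:=_; _:+_; _:*_)
  open SetoidReasoning setoid

  sA-suc-zero : ∀ p n → sA R p (suc n) 0 ≈ 0#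
  sA-suc-zero p zero    = zeroˡ _
  sA-suc-zero p (suc n) = trans (*-congˡ (sA-suc-zero p n)) (zeroʳ _)

  module _ (p x : Carrier) where

    sA-horner : ℕ → ℕ → Carrier
    sA-horner n zero    = sA R p n 0
    sA-horner n (suc m) = x * sA-horner n m + sA R p n (suc m)

    stirlingProd : ℕ → Carrier
    stirlingProd zero    = 1#
    stirlingProd (suc n) = stirlingProd n * (1# + qint R p n * x)

    sA-horner-suc : ∀ n m →
      sA-horner (suc n) (suc m) ≈ sA-horner n m + qint R p n * sA-horner n (suc m)
    sA-horner-suc n zero = solve 4
      (λ x a s₀ s₁ → x :* (a :* s₀) :+ (s₀ :+ a :* s₁) := s₀ :+ a :* (x :* s₀ :+ s₁))
      refl x (qint R p n) (sA R p n 0) (sA R p n 1)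
    sA-horner-suc n (suc m) = begin
      x * sA-horner (suc n) (suc m) + (s (suc m) + a * s (suc (suc m)))
        ≈⟨ +-congʳ (*-congˡ (sA-horner-suc n m)) ⟩
      x * (h m + a * h (suc m)) + (s (suc m) + a * s (suc (suc m)))
        ≈⟨ solve 6
             (λ x a h₀ h₁ s₁ s₂ → x :* (h₀ :+ a :* h₁) :+ (s₁ :+ a :* s₂)
                                := (x :* h₀ :+ s₁) :+ a :* (x :* h₁ :+ s₂))
             refl x a (h m) (h (suc m)) (s (suc m)) (s (suc (suc m))) ⟩
      h (suc m) + a * h (suc (suc m)) ∎
      where
      a = qint R p n
      h = sA-horner n
      s = sA R p n

    sA-horner-zero : ∀ m → sA-horner 0 m ≈ pow R x m
    sA-horner-zero zero    = refl
    sA-horner-zero (suc m) = trans (+-identityʳ _) (*-congˡ (sA-horner-zero m))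

    sA-horner-stable : ∀ d n → sA-horner n (d ℕ+ n) ≈ pow R x d * stirlingProd n
    sA-horner-stable d zero = begin
      sA-horner 0 (d ℕ+ 0) ≡⟨ cong (sA-horner 0) (ℕ.+-identityʳ d) ⟩
      sA-horner 0 d        ≈⟨ sA-horner-zero d ⟩
      pow R x d            ≈⟨ *-identityʳ _ ⟨
      pow R x d * 1#       ∎
    sA-horner-stable d (suc n) = begin
      sA-horner (suc n) (d ℕ+ suc n)  ≡⟨ cong (sA-horner (suc n)) (ℕ.+-suc d n) ⟩
      sA-horner (suc n) (suc (d ℕ+ n))
        ≈⟨ sA-horner-suc n (d ℕ+ n) ⟩
      sA-horner n (d ℕ+ n) + a * sA-horner n (suc d ℕ+ n)
        ≈⟨ +-cong (sA-horner-stable d n) (*-congˡ (sA-horner-stable (suc d) n)) ⟩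
      xᵈ * P + a * (x * xᵈ * P)
        ≈⟨ solve 4 (λ x xᵈ P a → xᵈ :* P :+ a :* (x :* xᵈ :* P) := xᵈ :* (P :* (con 1 :+ a :* x)))
             refl x xᵈ P a ⟩
      xᵈ * (P * (1# + a * x))         ∎
      where
      a  = qint R p n
      xᵈ = pow R x d
      P  = stirlingProd n

  module _ (q : Carrier) where

    private
      2*suc : ∀ k → 2 ℕ* suc k ≡ suc (suc (2 ℕ* k))
      2*suc k = ℕ.*-suc 2 k

    pow-square : ∀ k → pow R (q * q) k ≈ pow R q (2 ℕ* k)
    pow-square zero    = refl
    pow-square (suc k) = begin
      q * q * pow R (q * q) k   ≈⟨ *-congˡ (pow-square k) ⟩
      q * q * pow R q (2 ℕ* k)  ≈⟨ *-assoc _ _ _ ⟩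
      pow R q (suc (suc (2 ℕ* k))) ≡⟨ cong (pow R q) (2*suc k) ⟨
      pow R q (2 ℕ* suc k)      ∎

    qint-square-*-1+q : ∀ k → qint R (q * q) k * (1# + q) ≈ qint R q (2 ℕ* k)
    qint-square-*-1+q zero    = zeroˡ _
    qint-square-*-1+q (suc k) = begin
      (qint R (q * q) k + pow R (q * q) k) * (1# + q)
        ≈⟨ distribʳ _ _ _ ⟩
      qint R (q * q) k * (1# + q) + pow R (q * q) k * (1# + q)
        ≈⟨ +-cong (qint-square-*-1+q k) (*-congʳ (pow-square k)) ⟩
      qint R q (2 ℕ* k) + qᵏ * (1# + q)
        ≈⟨ solve 3 (λ i qᵏ q → i :+ qᵏ :* (con 1 :+ q) := (i :+ qᵏ) :+ q :* qᵏ) refl _ qᵏ q ⟩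
      qint R q (suc (suc (2 ℕ* k)))  ≡⟨ cong (qint R q) (2*suc k) ⟨
      qint R q (2 ℕ* suc k)          ∎
      where qᵏ = pow R q (2 ℕ* k)

    stirlingProd-square : ∀ m → stirlingProd (q * q) (1# + q) (suc m) ≈ lhsProd R q m
    stirlingProd-square zero =
      trans (*-identityˡ _) (trans (+-congˡ (zeroˡ _)) (+-identityʳ 1#))
    stirlingProd-square (suc m) =
      *-cong (stirlingProd-square m) (+-congˡ (qint-square-*-1+q (suc m)))

    sA-horner-rhsSum : ∀ n m → m ≤ n →
      sA-horner (q * q) (1# + q) n m * pow R (1# + q) (n ∸ m)
        ≈ sA R (q * q) n 0 * pow R (1# + q) n + rhsSum R q n m
    sA-horner-rhsSum n zero    _   = sym (+-identityʳ _)
    sA-horner-rhsSum n (suc m) m<n = begin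
      (x * h m + s (suc m)) * xⁿ⁻ᵐ⁻¹
        ≈⟨ solve 4 (λ x h s y → (x :* h :+ s) :* y := h :* (x :* y) :+ s :* y)
             refl x (h m) (s (suc m)) xⁿ⁻ᵐ⁻¹ ⟩
      h m * pow R x (suc (n ∸ suc m)) + s (suc m) * xⁿ⁻ᵐ⁻¹
        ≡⟨ cong (λ e → h m * pow R x e + s (suc m) * xⁿ⁻ᵐ⁻¹) (ℕ.+-∸-assoc 1 m<n) ⟨
      h m * pow R x (n ∸ m) + s (suc m) * xⁿ⁻ᵐ⁻¹
        ≈⟨ +-congʳ (sA-horner-rhsSum n m (ℕ.<⇒≤ m<n)) ⟩
      (s 0 * pow R x n + rhsSum R q n m) + s (suc m) * xⁿ⁻ᵐ⁻¹
        ≈⟨ +-assoc _ _ _ ⟩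
      s 0 * pow R x n + rhsSum R q n (suc m) ∎
      where
      x = 1# + q
      h = sA-horner (q * q) x n
      s = sA R (q * q) n
      xⁿ⁻ᵐ⁻¹ = pow R x (n ∸ suc m)

corollary4p28 : ∀ {c ℓ : Level} (R : CommutativeRing c ℓ) (q : CommutativeRing.Carrier R) (n : ℕ) →
    n ≥ 1 →
    CommutativeRing._≈_ R (CommutativeRing._*_ R (CommutativeRing.1# R) (lhsProd R q (n ∸ 1))) (rhsSum R q n n)
corollary4p28 R q (suc n) _ = begin
  1# * lhsProd R q n                      ≈⟨ *-congˡ (stirlingProd-square R q n) ⟨
  1# * stirlingProd R (q * q) x (suc n)   ≈⟨ sA-horner-stable R (q * q) x 0 (suc n) ⟨
  H                                       ≈⟨ *-identityʳ H ⟨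
  H * 1#                                  ≡⟨ cong (λ e → H * pow R x e) (ℕ.n∸n≡0 n) ⟨
  H * pow R x (suc n ∸ suc n)             ≈⟨ sA-horner-rhsSum R q (suc n) (suc n) ℕ.≤-refl ⟩
  sA R (q * q) (suc n) 0 * pow R x (suc n) + rhsSum R q (suc n) (suc n)
    ≈⟨ +-congʳ (trans (*-congʳ (sA-suc-zero R (q * q) n)) (zeroˡ _)) ⟩
  0# + rhsSum R q (suc n) (suc n)         ≈⟨ +-identityˡ _ ⟩
  rhsSum R q (suc n) (suc n)              ∎
  where
  open CommutativeRing R
  open SetoidReasoning setoid
  x = 1# + q
  H = sA-horner R (q * q) x (suc n) (suc n)
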